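{- Let $\Lambda\in\{\mathsf{ALR},\mathsf{PLR}\}$ and let $\Sigma$ be a finite adequate set. If $T\in W_c$ and $\gamma(\varphi,\psi)\in T\cap\Sigma$, then there exists $S\in W_c$ with $T_\Sigma\mathrel{R^\varphi_\Sigma}S_\Sigma$ and $\psi\in S$.
   Context: Formulas: $\varphi ::= p \mid \neg\varphi \mid \varphi\wedge\varphi \mid \Box\varphi \mid \gamma(\varphi,\varphi)$, with $\Diamond\varphi:=\neg\Box\neg\varphi$. $\mathsf{ALR}$: propositional tautologies, Modus Ponens, $\mathsf{S4}$ axioms and rules for $\Box$, plus Axiom 1: $\psi\vee(\varphi\wedge\gamma(\varphi,\psi))\to\Box(\varphi\to\gamma(\varphi,\psi))$; Axiom 2: $\Diamond(\varphi\wedge\gamma(\varphi,\psi))\to\gamma(\varphi,\psi)$; Rule 1: from $\varphi\to\varphi'$, $\psi\to\psi'$ infer $\gamma(\varphi,\psi)\to\gamma(\varphi',\psi')$; Rule 2: from $\psi\to\Box(\varphi\to\psi)$ and $\varphi\wedge\Diamond(\varphi\wedge\psi)\to\psi$ infer $\gamma(\varphi,\psi)\to\Diamond(\varphi\wedge\psi)$. $\mathsf{PLR}$ = $\mathsf{ALR}$ + $\Box(\Box(p\to\Box p)\to p)\to\Box p$. $W_c$ is the set of maximal $\Lambda$-consistent sets of formulas. A set $\Sigma$ is adequate if closed under subformulas and single negations (if $\varphi\in\Sigma$ is not a negation then $\neg\varphi\in\Sigma$), and $\gamma(\varphi,\psi)\in\Sigma$ implies $\Box(\varphi\to\gamma(\varphi,\psi)),\Diamond(\varphi\wedge\gamma(\varphi,\psi))\in\Sigma$.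 For $T,S\in W_c$ put $T\sim_\Sigma S$ iff $T\cap\Sigma=S\cap\Sigma$; $T_\Sigma$ is the class of $T$, $W_\Sigma$ the set of classes; $T_\Sigma\preccurlyeq_\Sigma S_\Sigma$ iff $\Box\chi\in T\cap\Sigma$ implies $\Box\chi\in S$. For $\varphi\in\Sigma$, $R^\varphi_\Sigma$ is the least relation on $W_\Sigma$ such that $T_\Sigma\mathrel{R^\varphi_\Sigma}S_\Sigma$ whenever there is $U\in W_c$ with $\varphi\in U$ and either $T_\Sigma\preccurlyeq_\Sigma U_\Sigma\succcurlyeq_\Sigma S_\Sigma$, or $T_\Sigma\mathrel{R^\varphi_\Sigma}U_\Sigma$ and $U_\Sigma\mathrel{R^\varphi_\Sigma}S_\Sigma$. -}

module Defs where

open import Data.Nat using (ℕ)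
open import Data.Bool using (Bool; true; false; not; _∧_)
open import Data.List using (List; []; _∷_)
open import Data.List.Membership.Propositional using (_∈_)
open import Data.List.Relation.Unary.All using (All)
open import Data.Product using (Σ; _×_; ∃)
open import Relation.Binary.PropositionalEquality using (_≡_)
open import Relation.Nullary using (¬_)
open import Level using (Level; suc; zero)

infixr 6 _⋀_
infixr 5 _⟶_
infixr 4 _⋁_

data Fm : Set where
  var : ℕ → Fm
  ~_  : Fm → Fm
  _⋀_ : Fm → Fm → Fm
  □_  : Fm → Fm
  γ   : Fm → Fm → Fm

_⟶_ : Fm → Fm → Fm
φ ⟶ ψ = ~ (φ ⋀ ~ ψ)

_⋁_ : Fm → Fm → Fm
φ ⋁ ψ = ~ (~ φ ⋀ ~ ψ)

◇_ : Fm → Fm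
◇ φ = ~ □ ~ φ

⊤′ : Fm
⊤′ = ~ (var 0 ⋀ ~ var 0)

-- Propositional tautologies: formulas true under every Boolean valuation
-- in which the modal formulas □χ and γ(χ,θ) (as well as variables) are
-- treated as atoms.  (= substitution instances of classical tautologies.)

eval : (Fm → Bool) → Fm → Bool
eval v (var n)   = v (var n)
eval v (~ φ)     = not (eval v φ)
eval v (φ ⋀ ψ)   = eval v φ ∧ eval v ψ
eval v (□ φ)     = v (□ φ)
eval v (γ φ ψ)   = v (γ φ ψ)

Taut : Fm → Set
Taut φ = (v : Fm → Bool) → eval v φ ≡ true

data Logic : Set where
  ALR PLR : Logic

infix 2 _⊢_

data _⊢_ (Λ : Logic) : Fm → Set where
  taut  : ∀ {φ} → Taut φ → Λ ⊢ φ
  mp    : ∀ {φ ψ} → Λ ⊢ φ ⟶ ψ → Λ ⊢ φ → Λ ⊢ ψ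
  axK   : ∀ {φ ψ} → Λ ⊢ □ (φ ⟶ ψ) ⟶ (□ φ ⟶ □ ψ)
  axT   : ∀ {φ} → Λ ⊢ □ φ ⟶ φ
  ax4   : ∀ {φ} → Λ ⊢ □ φ ⟶ □ □ φ
  nec   : ∀ {φ} → Λ ⊢ φ → Λ ⊢ □ φ
  ax1   : ∀ {φ ψ} → Λ ⊢ (ψ ⋁ (φ ⋀ γ φ ψ)) ⟶ □ (φ ⟶ γ φ ψ)
  ax2   : ∀ {φ ψ} → Λ ⊢ ◇ (φ ⋀ γ φ ψ) ⟶ γ φ ψ
  rule1 : ∀ {φ φ′ ψ ψ′} → Λ ⊢ φ ⟶ φ′ → Λ ⊢ ψ ⟶ ψ′ → Λ ⊢ γ φ ψ ⟶ γ φ′ ψ′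
  rule2 : ∀ {φ ψ} → Λ ⊢ ψ ⟶ □ (φ ⟶ ψ) → Λ ⊢ (φ ⋀ ◇ (φ ⋀ ψ)) ⟶ ψ
        → Λ ⊢ γ φ ψ ⟶ ◇ (φ ⋀ ψ)
  axPLR : ∀ {φ} → Λ ≡ PLR → Λ ⊢ □ (□ (φ ⟶ □ φ) ⟶ φ) ⟶ □ φ

FmSet : Set₁
FmSet = Fm → Set

conj : List Fm → Fm
conj []       = ⊤′
conj (φ ∷ l)  = φ ⋀ conj l

Consistent : Logic → FmSet → Set
Consistent Λ Γ = (l : List Fm) → All Γ l → ¬ (Λ ⊢ ~ conj l)

MaxCons : Logic → FmSet → Set₁
MaxCons Λ Γ = Consistent Λ Γ
            × ((Δ : FmSet) → (∀ φ → Γ φ → Δ φ) → Consistent Λ Δ → ∀ φ → Δ φ → Γ φ)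

record Wc (Λ : Logic) : Set₁ where
  constructor mkW
  field
    set : FmSet
    max : MaxCons Λ set
open Wc public

infix 4 _∈W_
_∈W_ : ∀ {Λ} → Fm → Wc Λ → Set
φ ∈W T = set T φ

data ImmSub : Fm → Fm → Set where
  s~  : ∀ {φ} → ImmSub φ (~ φ)
  s⋀ˡ : ∀ {φ ψ} → ImmSub φ (φ ⋀ ψ)
  s⋀ʳ : ∀ {φ ψ} → ImmSub ψ (φ ⋀ ψ)
  s□  : ∀ {φ} → ImmSub φ (□ φ)
  sγˡ : ∀ {φ ψ} → ImmSub φ (γ φ ψ)
  sγʳ : ∀ {φ ψ} → ImmSub ψ (γ φ ψ)

IsNeg : Fm → Set
IsNeg φ = ∃ λ χ → φ ≡ ~ χ

record Adequate (Σ′ : List Fm) : Set where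
  field
    subClosed : ∀ {φ ψ} → φ ∈ Σ′ → ImmSub ψ φ → ψ ∈ Σ′
    negClosed : ∀ {φ} → φ ∈ Σ′ → ¬ IsNeg φ → ~ φ ∈ Σ′
    γClosed₁  : ∀ {φ ψ} → γ φ ψ ∈ Σ′ → □ (φ ⟶ γ φ ψ) ∈ Σ′
    γClosed₂  : ∀ {φ ψ} → γ φ ψ ∈ Σ′ → ◇ (φ ⋀ γ φ ψ) ∈ Σ′

-- Filtration relations, on representatives (all are invariant under ∼_Σ)

module _ {Λ : Logic} (Σ′ : List Fm) where

  _∼_ : Wc Λ → Wc Λ → Set
  T ∼ S = ∀ φ → φ ∈ Σ′ → (φ ∈W T → φ ∈W S) × (φ ∈W S → φ ∈W T)

  _≼_ : Wc Λ → Wc Λ → Set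
  T ≼ S = ∀ χ → □ χ ∈ Σ′ → □ χ ∈W T → □ χ ∈W S

  data R (φ : Fm) : Wc Λ → Wc Λ → Set₁ where
    base  : ∀ {T S} (U : Wc Λ) → φ ∈W U → T ≼ U → S ≼ U → R φ T S
    trans : ∀ {T S} (U : Wc Λ) → φ ∈W U → R φ T U → R φ U S → R φ T S

{-# OPTIONS --safe #-}

-- Let C be the disjunction of the characteristic formulas of the types (truth assignments to Σ)
-- of the worlds R^φ-reachable from T. If no reachable world contained ψ, then ⊢ ψ → ¬C; as the
-- reachable types are closed under the links of R^φ, ¬C satisfies both premises of Rule 2, so
-- Rule 1 and Rule 2 turn γ(φ,ψ) ∈ T into ◇(φ ∧ ¬C) ∈ T. This gives a world above T containing φ
-- and ¬C, which is itself reachable and hence contains C.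
--
-- Constructively, reachability is computed on the finite set of types, with the link relation
-- decided under double negation; it stabilises within M = 2^|Σ| rounds, so every reachable type
-- ends a chain of exactly M links. Such a chain exists only up to double negation, but the first
-- one in an enumeration of all candidate chains is unique. The worlds along it are obtained by
-- Lindenbaum's lemma from the formulas true at the corresponding types of that chain, and
-- membership in a maximal consistent set is ¬¬-stable, so all required facts about them hold.

module Submission where

open import Defs
open import Data.Bool using (Bool; true; false; T; not; _∧_; _∨_; if_then_else_)
open import Data.Bool.ListAction using (any)
open import Data.Bool.Properties using (T-∧; T-∨; T-≡)
open import Data.Empty using (⊥; ⊥-elim)
open import Data.List using (List; []; _∷_; _++_; map; concat; foldr; filter; length; upTo; cartesianProductWith)
open import Data.List.Membership.Propositional using (_∈_; find; lose)
open import Data.List.Membership.Propositional.Properties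
  using (∈-map⁺; ∈-map⁻; ∈-filter⁺; ∈-filter⁻; ∈-concat⁺; ∈-upTo⁺; ∈-cartesianProductWith⁺; ∈-cartesianProduct⁺)
open import Data.List.Relation.Binary.Subset.Propositional using (_⊆_)
open import Data.List.Relation.Binary.Subset.Propositional.Properties using (⊆-trans; ∷⁺ʳ; ∈-∷⁺ʳ; xs⊆x∷xs)
open import Data.List.Relation.Unary.All as All using (All; []; _∷_)
open import Data.List.Relation.Unary.All.Properties using (++⁺; ++⁻ˡ; ++⁻ʳ; map⁺; ¬All⇒Any¬)
open import Data.List.Relation.Unary.Any using (Any; here; there)
open import Data.List.Relation.Unary.Any.Properties using (any⁺; any⁻)
open import Data.Nat using (ℕ; zero; suc; _≤_; _<_; _⊔_; _≤′_; ≤′-refl; ≤′-step; z≤n; s≤s)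
open import Data.Nat.Properties
  using (≤-refl; ≤-trans; m≤m⊔n; m≤n⊔m; m⊔n≤o⇒m≤o; m⊔n≤o⇒n≤o; ≤⇒≤′; m≤n⇒m≤1+n; m<n⇒m<1+n; <⇒≱)
open import Data.Product using (Σ; _×_; _,_; proj₁; proj₂)
open import Data.Sum using (_⊎_; inj₁; inj₂; [_,_]′)
open import Data.Vec using (Vec; []; _∷_; head; tail)
open import Function using (_∘_; id; case_of_)
open import Function.Bundles using (Equivalence)
open import Relation.Binary.PropositionalEquality using (_≡_; refl; sym; subst)
open import Relation.Nullary using (¬_; Dec; yes; no)
open import Relation.Nullary.Decidable
  using (decidable-stable; T?; ¬¬-excluded-middle; _→-dec_; isYes; toWitness; fromWitness)
open import Relation.Nullary.Negation using (¬¬-map)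

open Equivalence using (to; from)

private
  variable
    Λ : Logic
    Γ Δ : FmSet
    a b c χ : Fm
    l l₀ : List Fm
    v : Fm → Bool

-- Propositional reasoning

T-not : ∀ {x} → ¬ T x → T (not x)
T-not {false} _ = _
T-not {true} ¬x = ¬x _

¬T-not : ∀ {x} → T (not x) → ¬ T x
¬T-not {false} _ ()
¬T-not {true} ()

infix 4 _⊨_

record _⊨_ (v : Fm → Bool) (a : Fm) : Set where
  constructor ⟨_⟩
  field holds : T (eval v a)

open _⊨_

⊨-stable : ¬ ¬ v ⊨ a → v ⊨ a
⊨-stable ¬¬a = ⟨ decidable-stable (T? _) (λ ¬t → ¬¬a (¬t ∘ holds)) ⟩

⊨~⁺ : ¬ v ⊨ a → v ⊨ ~ a
⊨~⁺ ¬a = ⟨ T-not (¬a ∘ ⟨_⟩) ⟩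

⊨~⁻ : v ⊨ ~ a → ¬ v ⊨ a
⊨~⁻ ⟨ h ⟩ ⟨ ha ⟩ = ¬T-not h ha

⊨⋀⁺ : v ⊨ a → v ⊨ b → v ⊨ a ⋀ b
⊨⋀⁺ ⟨ ha ⟩ ⟨ hb ⟩ = ⟨ from T-∧ (ha , hb) ⟩

⊨⋀⁻ : v ⊨ a ⋀ b → v ⊨ a × v ⊨ b
⊨⋀⁻ ⟨ h ⟩ = let ha , hb = to T-∧ h in ⟨ ha ⟩ , ⟨ hb ⟩

⊨⟶⁺ : (v ⊨ a → v ⊨ b) → v ⊨ a ⟶ b
⊨⟶⁺ f = ⊨~⁺ λ h → let ha , h~b = ⊨⋀⁻ h in ⊨~⁻ h~b (f ha)

⊨⟶⁻ : v ⊨ a ⟶ b → v ⊨ a → v ⊨ b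
⊨⟶⁻ h ha = ⊨-stable λ ¬b → ⊨~⁻ h (⊨⋀⁺ ha (⊨~⁺ ¬b))

⊨⊤ : v ⊨ ⊤′
⊨⊤ = ⊨~⁺ λ h → let hp , h~p = ⊨⋀⁻ h in ⊨~⁻ h~p hp

⊨conj⁺ : All (v ⊨_) l → v ⊨ conj l
⊨conj⁺ [] = ⊨⊤
⊨conj⁺ (h ∷ hs) = ⊨⋀⁺ h (⊨conj⁺ hs)

⊨conj⁻ : v ⊨ conj l → All (v ⊨_) l
⊨conj⁻ {l = []} _ = []
⊨conj⁻ {l = _ ∷ _} h = let h₁ , h₂ = ⊨⋀⁻ h in h₁ ∷ ⊨conj⁻ h₂

⊢-taut : (∀ {v} → v ⊨ a) → Λ ⊢ a
⊢-taut h = taut λ v → to T-≡ (holds (h {v}))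

⊢-map : (∀ {v} → v ⊨ a → v ⊨ b) → Λ ⊢ a → Λ ⊢ b
⊢-map f = mp (⊢-taut (⊨⟶⁺ f))

⊢-map₂ : (∀ {v} → v ⊨ a → v ⊨ b → v ⊨ c) → Λ ⊢ a → Λ ⊢ b → Λ ⊢ c
⊢-map₂ f da db = mp (mp (⊢-taut (⊨⟶⁺ λ ha → ⊨⟶⁺ (f ha))) da) db

⊢-refute-head : Λ ⊢ ~ conj (a ∷ l) → Λ ⊢ conj l ⟶ ~ a
⊢-refute-head = ⊢-map λ h → ⊨⟶⁺ λ hl → ⊨~⁺ λ ha → ⊨~⁻ h (⊨⋀⁺ ha hl)

⊢-refute-~head : Λ ⊢ ~ conj (~ a ∷ l) → Λ ⊢ conj l ⟶ a
⊢-refute-~head = ⊢-map λ h → ⊨⟶⁺ λ hl → ⊨-stable λ ¬a → ⊨~⁻ h (⊨⋀⁺ (⊨~⁺ ¬a) hl)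

⊢-refute-⊆ : l ⊆ l₀ → Λ ⊢ ~ conj l → Λ ⊢ ~ conj l₀
⊢-refute-⊆ l⊆l₀ = ⊢-map λ h → ⊨~⁺ λ h₀ → ⊨~⁻ h (⊨conj⁺ (All.tabulate (All.lookup (⊨conj⁻ h₀) ∘ l⊆l₀)))

-- Maximal consistent sets

infix 4 _⊆ˢ_
infixl 6 _∪｛_｝

_⊆ˢ_ : FmSet → FmSet → Set
Γ ⊆ˢ Δ = ∀ {θ} → Γ θ → Δ θ

_∪｛_｝ : FmSet → Fm → FmSet
(Γ ∪｛ a ｝) θ = Γ θ ⊎ θ ≡ a

Consistent-antitone : Γ ⊆ˢ Δ → Consistent Λ Δ → Consistent Λ Γ
Consistent-antitone Γ⊆Δ con l hs = con l (All.map Γ⊆Δ hs)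

Consistent-⊆ : (∀ {θ} → Γ θ → θ ∈ l₀) → ¬ (Λ ⊢ ~ conj l₀) → Consistent Λ Γ
Consistent-⊆ Γ⊆l₀ con₀ l hs = con₀ ∘ ⊢-refute-⊆ (All.lookup (All.map Γ⊆l₀ hs))

split-∪ : All (Γ ∪｛ a ｝) l → Σ (List Fm) λ l′ → All Γ l′ × l ⊆ a ∷ l′
split-∪ [] = [] , [] , λ ()
split-∪ (inj₂ refl ∷ hs) =
  let l′ , hs′ , sub = split-∪ hs in
  l′ , hs′ , ∈-∷⁺ʳ (here refl) sub
split-∪ (inj₁ h ∷ hs) =
  let l′ , hs′ , sub = split-∪ hs in
  _ ∷ l′ , h ∷ hs′ , ∈-∷⁺ʳ (there (here refl)) (⊆-trans sub (∷⁺ʳ _ (xs⊆x∷xs _ _)))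

Consistent-∪ : (∀ l → All Γ l → ¬ (Λ ⊢ ~ conj (a ∷ l))) → Consistent Λ (Γ ∪｛ a ｝)
Consistent-∪ h l hs d = let l′ , hs′ , sub = split-∪ hs in h l′ hs′ (⊢-refute-⊆ sub d)

module _ {Λ : Logic} (W : Wc Λ) where

  W-consistent : Consistent Λ (set W)
  W-consistent = proj₁ (max W)

  ∈-maximal : Consistent Λ (set W ∪｛ a ｝) → a ∈W W
  ∈-maximal con = proj₂ (max W) _ (λ _ → inj₁) con _ (inj₂ refl)

  ∈-closed : All (set W) l → Λ ⊢ conj l ⟶ a → a ∈W W
  ∈-closed {l} hl d = ∈-maximal (Consistent-∪ λ l′ hl′ d′ →
    W-consistent (l′ ++ l) (++⁺ hl′ hl) (⊢-map₂ (λ h h′ → ⊨~⁺ λ h″ →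
      let hs = ⊨conj⁻ h″ in ⊨~⁻ h′ (⊨⋀⁺ (⊨⟶⁻ h (⊨conj⁺ (++⁻ʳ l′ hs))) (⊨conj⁺ (++⁻ˡ l′ hs)))) d d′))

  ⊢⇒∈ : Λ ⊢ a → a ∈W W
  ⊢⇒∈ d = ∈-closed [] (⊢-map (λ h → ⊨⟶⁺ λ _ → h) d)

  ∈-mp : a ∈W W → Λ ⊢ a ⟶ b → b ∈W W
  ∈-mp ha d = ∈-closed (ha ∷ []) (⊢-map (λ h → ⊨⟶⁺ λ hc → ⊨⟶⁻ h (proj₁ (⊨⋀⁻ hc))) d)

  ~∈⇒∉ : ~ a ∈W W → ¬ a ∈W W
  ~∈⇒∉ h~a ha = W-consistent (_ ∷ _ ∷ []) (ha ∷ h~a ∷ [])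
    (⊢-taut (⊨~⁺ λ h → let ha , h′ = ⊨⋀⁻ h in ⊨~⁻ (proj₁ (⊨⋀⁻ h′)) ha))

  ∉⇒~∈ : ¬ a ∈W W → ~ a ∈W W
  ∉⇒~∈ ¬a = ∈-maximal (Consistent-∪ λ l hl d → ¬a (∈-closed hl (⊢-refute-~head d)))

  ∈-stable : ¬ ¬ a ∈W W → a ∈W W
  ∈-stable ¬¬a = ∈-maximal (Consistent-∪ λ l hl d → ¬¬a (~∈⇒∉ (∈-closed hl (⊢-refute-head d))))

  ~~∈⁻ : ~ ~ a ∈W W → a ∈W W
  ~~∈⁻ h = ∈-stable λ ¬a → ~∈⇒∉ h (∉⇒~∈ ¬a)

  ⋀∈⁺ : a ∈W W → b ∈W W → a ⋀ b ∈W W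
  ⋀∈⁺ ha hb = ∈-closed (ha ∷ hb ∷ [])
    (⊢-taut (⊨⟶⁺ λ h → let h₁ , h′ = ⊨⋀⁻ h in ⊨⋀⁺ h₁ (proj₁ (⊨⋀⁻ h′))))

  ⋀∈⁻ : a ⋀ b ∈W W → a ∈W W × b ∈W W
  ⋀∈⁻ h = ∈-mp h (⊢-taut (⊨⟶⁺ (proj₁ ∘ ⊨⋀⁻))) , ∈-mp h (⊢-taut (⊨⟶⁺ (proj₂ ∘ ⊨⋀⁻)))

  ⟶∈⁺ : (a ∈W W → b ∈W W) → a ⟶ b ∈W W
  ⟶∈⁺ f = ∉⇒~∈ λ h → let ha , h~b = ⋀∈⁻ h in ~∈⇒∉ h~b (f ha)

  ~⟶∈⁻ : ~ (a ⟶ b) ∈W W → a ∈W W × ~ b ∈W W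
  ~⟶∈⁻ h = ⋀∈⁻ (~~∈⁻ h)

  conj∈⁺ : All (set W) l → conj l ∈W W
  conj∈⁺ hl = ∈-closed hl (⊢-taut (⊨⟶⁺ id))

  conj∈⁻ : conj l ∈W W → All (set W) l
  conj∈⁻ {[]} _ = []
  conj∈⁻ {_ ∷ _} h = let h₁ , h₂ = ⋀∈⁻ h in h₁ ∷ conj∈⁻ h₂

disj : List Fm → Fm
disj = foldr _⋁_ (~ ⊤′)

module _ {Λ : Logic} (W : Wc Λ) where

  disj∈⁺ : a ∈ l → a ∈W W → disj l ∈W W
  disj∈⁺ (here refl) ha = ∉⇒~∈ W λ h → ~∈⇒∉ W (proj₁ (⋀∈⁻ W h)) ha
  disj∈⁺ (there a∈) ha = ∉⇒~∈ W λ h → ~∈⇒∉ W (proj₂ (⋀∈⁻ W h)) (disj∈⁺ a∈ ha)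

  disj∈⁻ : disj l ∈W W → ¬ ¬ Σ Fm λ a → a ∈ l × a ∈W W
  disj∈⁻ {[]} h _ = ~∈⇒∉ W h (⊢⇒∈ W (⊢-taut ⊨⊤))
  disj∈⁻ {a ∷ l} h ¬any =
    disj∈⁻ (∈-stable W λ ∉l → ~∈⇒∉ W h (⋀∈⁺ W (∉⇒~∈ W λ ha → ¬any (a , here refl , ha)) (∉⇒~∈ W ∉l)))
      λ (b , b∈ , hb) → ¬any (b , there b∈ , hb)

increasing⇒monotone : {A : Set} (P : ℕ → A → Set) → (∀ {k x} → P k x → P (suc k) x) →
                      ∀ {m n x} → m ≤ n → P m x → P n x
increasing⇒monotone P step m≤n = go (≤⇒≤′ m≤n)
  where
    go : ∀ {m n x} → m ≤′ n → P m x → P n x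
    go ≤′-refl h = h
    go (≤′-step m≤n) h = step (go m≤n h)

rank : Fm → ℕ
rank (var k) = suc k
rank (~ a) = suc (rank a)
rank (a ⋀ b) = suc (rank a ⊔ rank b)
rank (□ a) = suc (rank a)
rank (γ a b) = suc (rank a ⊔ rank b)

layer : ℕ → List Fm → List (List Fm)
layer n fs =
  map var (upTo (suc n)) ∷ map ~_ fs ∷ cartesianProductWith _⋀_ fs fs ∷
  map □_ fs ∷ cartesianProductWith γ fs fs ∷ []

formulas : ℕ → List Fm
formulas zero = []
formulas (suc n) = concat (layer n (formulas n))

∈-layer : ∀ n → Any (a ∈_) (layer n (formulas n)) → a ∈ formulas (suc n)
∈-layer n = ∈-concat⁺

formulas-complete : ∀ a {n} → rank a ≤ n → a ∈ formulas n
formulas-complete (var k) {suc n} r = ∈-layer n (here (∈-map⁺ var (∈-upTo⁺ r)))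
formulas-complete (~ a) {suc n} (s≤s r) = ∈-layer n (there (here (∈-map⁺ ~_ (formulas-complete a r))))
formulas-complete (a ⋀ b) {suc n} (s≤s r) = ∈-layer n (there (there (here (∈-cartesianProductWith⁺ _⋀_
  (formulas-complete a (m⊔n≤o⇒m≤o _ _ r)) (formulas-complete b (m⊔n≤o⇒n≤o _ _ r))))))
formulas-complete (□ a) {suc n} (s≤s r) =
  ∈-layer n (there (there (there (here (∈-map⁺ □_ (formulas-complete a r))))))
formulas-complete (γ a b) {suc n} (s≤s r) = ∈-layer n (there (there (there (there (here (∈-cartesianProductWith⁺ γ
  (formulas-complete a (m⊔n≤o⇒m≤o _ _ r)) (formulas-complete b (m⊔n≤o⇒n≤o _ _ r))))))))

module Lindenbaum {Λ : Logic} (Γ : FmSet) (Γ-consistent : Consistent Λ Γ) where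

  extend : FmSet → Fm → FmSet
  extend Δ a θ = Δ θ ⊎ (θ ≡ a × Consistent Λ (Δ ∪｛ a ｝))

  extendAll : FmSet → List Fm → FmSet
  extendAll Δ [] = Δ
  extendAll Δ (a ∷ as) = extendAll (extend Δ a) as

  -- Consistency of Δ ∪ {a} is undecidable, but the goal is a negation, so excluded middle is available.
  extend-consistent : Consistent Λ Δ → Consistent Λ (extend Δ a)
  extend-consistent con l hs d = ¬¬-excluded-middle λ where
    (yes con′) → con′ l (All.map (λ { (inj₁ h) → inj₁ h ; (inj₂ (refl , _)) → inj₂ refl }) hs) d
    (no ¬con′) → con l (All.map (λ { (inj₁ h) → h ; (inj₂ (_ , con′)) → ⊥-elim (¬con′ con′) }) hs) d

  extendAll-consistent : ∀ as → Consistent Λ Δ → Consistent Λ (extendAll Δ as)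
  extendAll-consistent [] con = con
  extendAll-consistent (a ∷ as) con = extendAll-consistent as (extend-consistent con)

  extendAll-⊇ : ∀ as → Δ ⊆ˢ extendAll Δ as
  extendAll-⊇ [] h = h
  extendAll-⊇ (a ∷ as) h = extendAll-⊇ as (inj₁ h)

  extendAll-∈ : ∀ {Δ′} as → extendAll Δ as ⊆ˢ Δ′ → Consistent Λ Δ′ → a ∈ as → Δ′ a → extendAll Δ as a
  extendAll-∈ (a ∷ as) sub con (here refl) h = extendAll-⊇ as (inj₂ (refl ,
    Consistent-antitone (λ { (inj₁ h′) → sub (extendAll-⊇ as (inj₁ h′)) ; (inj₂ refl) → h }) con))
  extendAll-∈ (_ ∷ as) sub con (there a∈) h = extendAll-∈ as sub con a∈ h

  stage : ℕ → FmSet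
  stage zero = Γ
  stage (suc n) = extendAll (stage n) (formulas n)

  stage-mono : ∀ {m n} → m ≤ n → stage m ⊆ˢ stage n
  stage-mono m≤n = increasing⇒monotone stage (λ {n} → extendAll-⊇ (formulas n)) m≤n

  limit : FmSet
  limit θ = Σ ℕ λ n → stage n θ

  common-stage : All limit l → Σ ℕ λ n → All (stage n) l
  common-stage [] = 0 , []
  common-stage ((m , h) ∷ hs) =
    let n , hs′ = common-stage hs in
    m ⊔ n , stage-mono (m≤m⊔n m n) h ∷ All.map (stage-mono (m≤n⊔m m n)) hs′

  stage-consistent : ∀ n → Consistent Λ (stage n)
  stage-consistent zero = Γ-consistent
  stage-consistent (suc n) = extendAll-consistent (formulas n) (stage-consistent n)

  limit-consistent : Consistent Λ limit
  limit-consistent l hs = let n , hs′ = common-stage hs in stage-consistent n l hs′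

  limit-maximal : (Δ : FmSet) → (∀ θ → limit θ → Δ θ) → Consistent Λ Δ → ∀ θ → Δ θ → limit θ
  limit-maximal Δ sub con θ h = suc (rank θ) ,
    extendAll-∈ (formulas (rank θ)) (λ h′ → sub _ (suc (rank θ) , h′)) con (formulas-complete θ ≤-refl) h

lindenbaum : (Γ : FmSet) → Consistent Λ Γ → Σ (Wc Λ) λ W → Γ ⊆ˢ set W
lindenbaum Γ con = mkW limit (limit-consistent , limit-maximal) , λ h → 0 , h
  where open Lindenbaum Γ con

infix 4 _≤□_

_≤□_ : Wc Λ → Wc Λ → Set
V ≤□ W = ∀ {θ} → □ θ ∈W V → □ θ ∈W W

⊢-K-conj : Λ ⊢ conj l ⟶ a → Λ ⊢ conj (map □_ l) ⟶ □ a
⊢-K-conj {l = []} d = ⊢-map (λ h → ⊨⟶⁺ λ _ → h) (nec (mp d (⊢-taut ⊨⊤)))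
⊢-K-conj {l = b ∷ l} d = ⊢-map₂
  (λ h₁ h₂ → ⊨⟶⁺ λ hc → let h□b , hl = ⊨⋀⁻ hc in ⊨⟶⁻ (⊨⟶⁻ h₂ (⊨⟶⁻ h₁ hl)) h□b)
  (⊢-K-conj {l = l} (⊢-map (λ h → ⊨⟶⁺ λ hl → ⊨⟶⁺ λ hb → ⊨⟶⁻ h (⊨⋀⁺ hb hl)) d))
  axK

~□-witness : (V : Wc Λ) → ~ □ χ ∈W V → Σ (Wc Λ) λ W → ~ χ ∈W W × V ≤□ W
~□-witness {Λ} {χ} V h~□χ =
  let W , seed⊆W = lindenbaum seed seed-consistent in
  W , seed⊆W (inj₂ refl) , λ h□ → seed⊆W (inj₁ (∈-mp V h□ ax4))
  where
    seed : FmSet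
    seed = (λ θ → □ θ ∈W V) ∪｛ ~ χ ｝
    seed-consistent : Consistent Λ seed
    seed-consistent = Consistent-∪ λ l h□l d →
      ~∈⇒∉ V h~□χ (∈-closed V (map⁺ h□l) (⊢-K-conj (⊢-refute-~head d)))

∈-every⇒¬¬⊢ : (∀ (W : Wc Λ) → a ∈W W) → ¬ ¬ (Λ ⊢ a)
∈-every⇒¬¬⊢ {Λ} {a} ∈every ⊬a =
  let W , seed⊆W = lindenbaum (_≡ ~ a) (Consistent-⊆ (λ { refl → here refl }) λ d → ⊬a (⊢-map ⊨~~a d))
  in ~∈⇒∉ W (seed⊆W refl) (∈every W)
  where
    ⊨~~a : ∀ {v} → v ⊨ ~ conj (~ a ∷ []) → v ⊨ a
    ⊨~~a h = ⊨-stable λ ¬a → ⊨~⁻ h (⊨⋀⁺ (⊨~⁺ ¬a) ⊨⊤)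

-- Finite combinatorics

vectors : {A : Set} → List A → ∀ k → List (Vec A k)
vectors xs zero = [] ∷ []
vectors xs (suc k) = cartesianProductWith _∷_ xs (vectors xs k)

vectors-complete : {A : Set} {xs : List A} → (∀ x → x ∈ xs) → ∀ {k} (u : Vec A k) → u ∈ vectors xs k
vectors-complete _∈xs [] = here refl
vectors-complete _∈xs (x ∷ u) = ∈-cartesianProductWith⁺ _∷_ (x ∈xs) (vectors-complete _∈xs u)

¬¬-decide : {A : Set} {xs : List A} → (∀ x → x ∈ xs) → (P : A → Set) → ¬ ¬ (∀ x → Dec (P x))
¬¬-decide {xs = xs} _∈xs P = ¬¬-map (λ ds x → All.lookup ds (x ∈xs)) (decide-all xs)
  where
    decide-all : ∀ xs → ¬ ¬ All (Dec ∘ P) xs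
    decide-all [] k = k []
    decide-all (x ∷ xs) k = ¬¬-excluded-middle λ d → decide-all xs λ ds → k (d ∷ ds)

module FirstWitness {A : Set} (P : A → Set) where

  First : List A → A → Set
  First [] _ = ⊥
  First (y ∷ ys) x = (y ≡ x × P y) ⊎ (¬ P y × First ys x)

  First⇒P : ∀ xs {x} → First xs x → P x
  First⇒P (y ∷ ys) (inj₁ (refl , py)) = py
  First⇒P (y ∷ ys) (inj₂ (_ , f)) = First⇒P ys f

  First-unique : ∀ xs {x x′} → First xs x → First xs x′ → x ≡ x′
  First-unique (y ∷ ys) (inj₁ (refl , _)) (inj₁ (refl , _)) = refl
  First-unique (y ∷ ys) (inj₁ (refl , py)) (inj₂ (¬py , _)) = ⊥-elim (¬py py)
  First-unique (y ∷ ys) (inj₂ (¬py , _)) (inj₁ (refl , py)) = ⊥-elim (¬py py)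
  First-unique (y ∷ ys) (inj₂ (_ , f)) (inj₂ (_ , f′)) = First-unique ys f f′

  ¬¬-First : ∀ {xs x} → x ∈ xs → P x → ¬ ¬ Σ A (First xs)
  ¬¬-First {y ∷ ys} x∈ px k =
    ¬¬-excluded-middle λ { (yes py) → k (y , inj₁ (refl , py)) ; (no ¬py) → skip x∈ ¬py }
    where
      skip : _ ∈ y ∷ ys → ¬ P y → ⊥
      skip (here refl) ¬py = ¬py px
      skip (there x∈′) ¬py = ¬¬-First x∈′ px λ (z , f) → k (z , inj₂ (¬py , f))

module _ {A : Set} where

  count : (A → Bool) → List A → ℕ
  count p [] = 0
  count p (x ∷ xs) = if p x then suc (count p xs) else count p xs

  count≤length : ∀ p (xs : List A) → count p xs ≤ length xs
  count≤length p [] = z≤n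
  count≤length p (x ∷ xs) with p x
  ... | true = s≤s (count≤length p xs)
  ... | false = m≤n⇒m≤1+n (count≤length p xs)

  count-mono : ∀ {p q} → (∀ {x} → T (p x) → T (q x)) → ∀ xs → count p xs ≤ count q xs
  count-mono p⇒q [] = z≤n
  count-mono {p} {q} p⇒q (x ∷ xs) with p x in px | q x in qx
  ... | true | true = s≤s (count-mono p⇒q xs)
  ... | true | false = ⊥-elim (subst T qx (p⇒q (subst T (sym px) _)))
  ... | false | true = m≤n⇒m≤1+n (count-mono p⇒q xs)
  ... | false | false = count-mono p⇒q xs

  count-strict : ∀ {p q} → (∀ {x} → T (p x) → T (q x)) →
                 ∀ {x xs} → x ∈ xs → ¬ T (p x) → T (q x) → count p xs < count q xs
  count-strict {p} {q} p⇒q {xs = y ∷ ys} (here refl) ¬py qy with p y | q y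
  ... | true | _ = ⊥-elim (¬py _)
  ... | false | true = s≤s (count-mono p⇒q ys)
  count-strict {p} {q} p⇒q {xs = y ∷ ys} (there x∈) ¬px qx with p y in py | q y in qy
  ... | true | true = s≤s (count-strict p⇒q x∈ ¬px qx)
  ... | true | false = ⊥-elim (subst T qy (p⇒q (subst T (sym py) _)))
  ... | false | true = m≤n⇒m≤1+n (count-strict p⇒q x∈ ¬px qx)
  ... | false | false = count-strict p⇒q x∈ ¬px qx

module Stabilisation {A : Set} (f : ℕ → A → Bool) (f-step : ∀ {k x} → T (f k x) → T (f (suc k) x))
                     (xs : List A) where

  Stable : ℕ → Set
  Stable k = All (λ x → T (f (suc k) x) → T (f k x)) xs

  growth : ∀ k → ¬ Stable k → count (f k) xs < count (f (suc k)) xs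
  growth k ¬st =
    let x , x∈ , ¬imp = find (¬All⇒Any¬ (λ x → T? (f (suc k) x) →-dec T? (f k x)) xs ¬st) in
    count-strict f-step x∈ (λ fk → ¬imp (λ _ → fk))
      (decidable-stable (T? _) λ ¬fsk → ¬imp (λ fsk → ⊥-elim (¬fsk fsk)))

  search : ∀ m → (Σ ℕ λ k → k < m × Stable k) ⊎ m ≤ count (f m) xs
  search zero = inj₂ z≤n
  search (suc m) with search m | All.all? (λ x → T? (f (suc m) x) →-dec T? (f m x)) xs
  ... | inj₁ (k , k<m , st) | _ = inj₁ (k , m<n⇒m<1+n k<m , st)
  ... | inj₂ _ | yes st = inj₁ (m , ≤-refl , st)
  ... | inj₂ m≤c | no ¬st = inj₂ (≤-trans (s≤s m≤c) (growth m ¬st))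

  stabilises : Σ ℕ λ k → k ≤ length xs × Stable k
  stabilises with search (suc (length xs))
  ... | inj₁ (k , s≤s k≤n , st) = k , k≤n , st
  ... | inj₂ n<c = ⊥-elim (<⇒≱ n<c (count≤length _ xs))

-- Types: truth assignments to a list of formulas

literal : Fm → Bool → Fm
literal a true = a
literal a false = ~ a

char : (l : List Fm) → Vec Bool (length l) → List Fm
char [] [] = []
char (a ∷ l) (b ∷ τ) = literal a b ∷ char l τ

bit : a ∈ l → Vec Bool (length l) → Bool
bit (here _) (b ∷ _) = b
bit (there a∈) (_ ∷ τ) = bit a∈ τ

record _⊩[_]_ {Λ : Logic} (W : Wc Λ) (l : List Fm) (τ : Vec Bool (length l)) : Set where
  constructor ⊩-intro
  field literals : All (set W) (char l τ)

module _ {Λ : Logic} {W : Wc Λ} where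

  bit⇒∈ : ∀ {τ} → W ⊩[ l ] τ → (a∈ : a ∈ l) → T (bit a∈ τ) → a ∈W W
  bit⇒∈ {τ = true ∷ _} (⊩-intro (h ∷ _)) (here refl) _ = h
  bit⇒∈ {τ = _ ∷ _} (⊩-intro (_ ∷ hs)) (there a∈) t = bit⇒∈ (⊩-intro hs) a∈ t

  ∈⇒bit : ∀ {τ} → W ⊩[ l ] τ → (a∈ : a ∈ l) → a ∈W W → T (bit a∈ τ)
  ∈⇒bit {τ = true ∷ _} _ (here refl) _ = _
  ∈⇒bit {τ = false ∷ _} (⊩-intro (h ∷ _)) (here refl) ha = ~∈⇒∉ W h ha
  ∈⇒bit {τ = _ ∷ _} (⊩-intro (_ ∷ hs)) (there a∈) ha = ∈⇒bit (⊩-intro hs) a∈ ha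

  ⊩-consistent : ∀ {τ} → W ⊩[ l ] τ → ¬ (Λ ⊢ ~ conj (char l τ))
  ⊩-consistent (⊩-intro hs) d = ~∈⇒∉ W (⊢⇒∈ W d) (conj∈⁺ W hs)

type-exists : {Λ : Logic} (W : Wc Λ) (l : List Fm) → ¬ ¬ Σ (Vec Bool (length l)) (W ⊩[ l ]_)
type-exists W [] k = k ([] , ⊩-intro [])
type-exists W (a ∷ l) k = type-exists W l λ (τ , ⊩-intro hs) → ¬¬-excluded-middle λ where
  (yes ha) → k (true ∷ τ , ⊩-intro (ha ∷ hs))
  (no ¬ha) → k (false ∷ τ , ⊩-intro (∉⇒~∈ W ¬ha ∷ hs))

module Filtration {Λ : Logic} (Σ′ : List Fm) where

  Ty : Set
  Ty = Vec Bool (length Σ′)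

  types : List Ty
  types = vectors (true ∷ false ∷ []) (length Σ′)

  types-complete : ∀ τ → τ ∈ types
  types-complete = vectors-complete λ { true → here refl ; false → there (here refl) }

  infix 4 _⊩_ _≤ᵗ_

  _⊩_ : Wc Λ → Ty → Set
  W ⊩ τ = W ⊩[ Σ′ ] τ

  Consistentᵗ : Ty → Set
  Consistentᵗ τ = ¬ (Λ ⊢ ~ conj (char Σ′ τ))

  _≤ᵗ_ : Ty → Ty → Set
  τ ≤ᵗ σ = ∀ {χ} (□χ∈ : □ χ ∈ Σ′) → T (bit □χ∈ τ) → T (bit □χ∈ σ)

  ≤ᵗ-refl : ∀ {τ} → τ ≤ᵗ τ
  ≤ᵗ-refl _ t = t

  ≤□⇒≤ᵗ : ∀ {V W τ σ} → V ⊩ τ → W ⊩ σ → V ≤□ W → τ ≤ᵗ σ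
  ≤□⇒≤ᵗ V⊩τ W⊩σ V≤W □χ∈ t = ∈⇒bit W⊩σ □χ∈ (V≤W (bit⇒∈ V⊩τ □χ∈ t))

  ≤ᵗ⇒≼ : ∀ {V W τ σ} → V ⊩ τ → W ⊩ σ → τ ≤ᵗ σ → _≼_ Σ′ V W
  ≤ᵗ⇒≼ V⊩τ W⊩σ τ≤σ χ □χ∈ h = bit⇒∈ W⊩σ □χ∈ (τ≤σ □χ∈ (∈⇒bit V⊩τ □χ∈ h))

  typeFormulas : (Ty → Bool) → List Fm
  typeFormulas S = map (conj ∘ char Σ′) (filter (T? ∘ S) types)

  ⟦_⟧ : (Ty → Bool) → Fm
  ⟦ S ⟧ = disj (typeFormulas S)

  ⟦⟧-intro : ∀ {S W τ} → W ⊩ τ → T (S τ) → ⟦ S ⟧ ∈W W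
  ⟦⟧-intro {S} {W} {τ} (⊩-intro hs) Sτ =
    disj∈⁺ W (∈-map⁺ (conj ∘ char Σ′) (∈-filter⁺ (T? ∘ S) (types-complete τ) Sτ)) (conj∈⁺ W hs)

  ⟦⟧-elim : ∀ {S} (W : Wc Λ) → ⟦ S ⟧ ∈W W → ¬ ¬ Σ Ty λ τ → T (S τ) × W ⊩ τ
  ⟦⟧-elim {S} W h k = disj∈⁻ W {l = typeFormulas S} h λ (a , a∈ , ha) →
    case ∈-map⁻ (conj ∘ char Σ′) a∈ of λ where
      (τ , τ∈ , refl) → k (τ , proj₂ (∈-filter⁻ (T? ∘ S) {xs = types} τ∈) , ⊩-intro (conj∈⁻ W ha))

-- Chains of types

module Chains {Λ : Logic} (Σ′ : List Fm) (T₀ : Wc Λ) {φ ψ : Fm} (φ∈Σ : φ ∈ Σ′) (ψ∈Σ : ψ ∈ Σ′) where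

  open Filtration {Λ} Σ′

  infix 5 _▸_

  record Step : Set where
    constructor _▸_
    field apex target : Ty

  open Step

  -- The base clause of R^φ on types: σ ≼ u ≽ τ with φ ∈ u, for u the apex and τ the target of the step.
  record Link (σ : Ty) (s : Step) : Set where
    field
      apex-consistent   : Consistentᵗ (apex s)
      φ∈apex            : T (bit φ∈Σ (apex s))
      below-apex        : σ ≤ᵗ apex s
      target-below-apex : target s ≤ᵗ apex s
      target-consistent : Consistentᵗ (target s)

  open Link

  Linked : Ty → Ty → Set
  Linked σ τ = Σ Ty λ u → Link σ (u ▸ τ)

  linked-via : ∀ {X Y U σ τ υ} → X ⊩ σ → Y ⊩ τ → U ⊩ υ → φ ∈W U → X ≤□ U → Y ≤□ U → Linked σ τ
  linked-via X⊩σ Y⊩τ U⊩υ φ∈U X≤U Y≤U = _ , record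
    { apex-consistent   = ⊩-consistent U⊩υ
    ; φ∈apex            = ∈⇒bit U⊩υ φ∈Σ φ∈U
    ; below-apex        = ≤□⇒≤ᵗ X⊩σ U⊩υ X≤U
    ; target-below-apex = ≤□⇒≤ᵗ Y⊩τ U⊩υ Y≤U
    ; target-consistent = ⊩-consistent Y⊩τ
    }

  -- Steps are listed last first. A chain starts with a link from a type of T₀, and its intermediate
  -- targets contain φ.
  Chain : ∀ k → Vec Step (suc k) → Set
  Chain zero r = Σ Ty λ τ₀ → T₀ ⊩ τ₀ × Link τ₀ (head r)
  Chain (suc k) r =
    Link (target (head (tail r))) (head r) × T (bit φ∈Σ (target (head (tail r)))) × Chain k (tail r)

  first-link : ∀ k {r} → Chain k r → Σ Ty λ σ → Link σ (head r)
  first-link zero (τ₀ , _ , l) = τ₀ , l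
  first-link (suc k) (l , _ , _) = _ , l

  Chain-map-head : ∀ k {r s} → (∀ {σ} → Link σ (head r) → Link σ s) → Chain k r → Chain k (s ∷ tail r)
  Chain-map-head zero f (τ₀ , T₀⊩τ₀ , l) = τ₀ , T₀⊩τ₀ , f l
  Chain-map-head (suc k) f (l , φx , c) = f l , φx , c

  Reaches : ℕ → Ty → Set
  Reaches k τ = Σ (Vec Step (suc k)) λ r → Chain k r × target (head r) ≡ τ

  -- Repeating the apex of the last step as an intermediate target lengthens a chain by one.
  Reaches-pad : ∀ {k τ} → Reaches k τ → Reaches (suc k) τ
  Reaches-pad {k} (s ∷ r , c , e) =
    let _ , l = first-link k c in
    s ∷ (apex s ▸ apex s) ∷ r , (loop-back l , φ∈apex l , Chain-map-head k loop c) , e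
    where
      loop-back : ∀ {σ} → Link σ s → Link (apex s) s
      loop-back l = record
        { apex-consistent = apex-consistent l ; φ∈apex = φ∈apex l ; below-apex = ≤ᵗ-refl
        ; target-below-apex = target-below-apex l ; target-consistent = target-consistent l }
      loop : ∀ {σ} → Link σ s → Link σ (apex s ▸ apex s)
      loop l′ = record
        { apex-consistent = apex-consistent l′ ; φ∈apex = φ∈apex l′ ; below-apex = below-apex l′
        ; target-below-apex = ≤ᵗ-refl ; target-consistent = apex-consistent l′ }

  Reaches-extend : ∀ {k σ τ} → Reaches k σ → T (bit φ∈Σ σ) → Linked σ τ → Reaches (suc k) τ
  Reaches-extend (r , c , refl) φσ (u , l) = (u ▸ _) ∷ r , (l , φσ , c) , refl

  steps : List Step
  steps = cartesianProductWith _▸_ types types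

  steps-complete : ∀ s → s ∈ steps
  steps-complete (u ▸ x) = ∈-cartesianProductWith⁺ _▸_ (types-complete u) (types-complete x)

  M : ℕ
  M = length types

  Path : Set
  Path = Vec Step (suc M)

  Valid : Path → Set
  Valid r = Chain M r × T (bit ψ∈Σ (target (head r)))

  paths-complete : ∀ r → r ∈ vectors steps (suc M)
  paths-complete = vectors-complete steps-complete

  module Search (linked? : ∀ σ τ → Dec (Linked σ τ)) (τ₀ : Ty) (T₀⊩τ₀ : T₀ ⊩ τ₀) where

    reach : ℕ → Ty → Bool
    reach zero τ = isYes (linked? τ₀ τ)
    reach (suc k) τ = reach k τ ∨ any (λ σ → reach k σ ∧ bit φ∈Σ σ ∧ isYes (linked? σ τ)) types

    reach-step : ∀ {k τ} → T (reach k τ) → T (reach (suc k) τ)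
    reach-step h = from T-∨ (inj₁ h)

    reach-mono : ∀ {k n τ} → k ≤ n → T (reach k τ) → T (reach n τ)
    reach-mono = increasing⇒monotone (λ k τ → T (reach k τ)) (λ {k} {τ} → reach-step {k} {τ})

    reach⇒Reaches : ∀ k {τ} → T (reach k τ) → Reaches k τ
    reach⇒Reaches zero h = let u , l = toWitness h in (u ▸ _) ∷ [] , (τ₀ , T₀⊩τ₀ , l) , refl
    reach⇒Reaches (suc k) h = [ Reaches-pad ∘ reach⇒Reaches k , via-predecessor ]′ (to T-∨ h)
      where
        via-predecessor : T (any (λ σ → reach k σ ∧ bit φ∈Σ σ ∧ isYes (linked? σ _)) types) →
                          Reaches (suc k) _
        via-predecessor h′ =
          let σ , _ , hσ = find (any⁻ _ types h′)
              rσ , hσ′ = to T-∧ hσ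
              φσ , lσ = to T-∧ hσ′
          in Reaches-extend (reach⇒Reaches k rσ) φσ (toWitness lσ)

    open Stabilisation reach (λ {k} {τ} → reach-step {k} {τ}) types

    private
      stabilisation : Σ ℕ λ k → k ≤ M × Stable k
      stabilisation = stabilises

    reached : Ty → Bool
    reached = reach (proj₁ stabilisation)

    reached-start : ∀ {τ} → Linked τ₀ τ → T (reached τ)
    reached-start l = reach-mono {n = proj₁ stabilisation} z≤n (fromWitness l)

    reached-closed : ∀ {σ τ} → T (reached σ) → T (bit φ∈Σ σ) → Linked σ τ → T (reached τ)
    reached-closed {σ} {τ} rσ φσ l =
      All.lookup (proj₂ (proj₂ stabilisation)) (types-complete τ)
        (from T-∨ (inj₂ (any⁺ _ (lose (types-complete σ) (from T-∧ (rσ , from T-∧ (φσ , fromWitness l)))))))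

    reached⇒Reaches : ∀ {τ} → T (reached τ) → Reaches M τ
    reached⇒Reaches = reach⇒Reaches M ∘ reach-mono (proj₁ (proj₂ stabilisation))

  module Refutation (γ∈T₀ : γ φ ψ ∈W T₀) (linked? : ∀ σ τ → Dec (Linked σ τ)) (τ₀ : Ty) (T₀⊩τ₀ : T₀ ⊩ τ₀) where

    open Search linked? τ₀ T₀⊩τ₀

    C : Fm
    C = ⟦ reached ⟧

    premise-ψ : ¬ Σ Path Valid → ∀ W → ψ ⟶ ~ C ∈W W
    premise-ψ no-path W = ⟶∈⁺ W λ ψ∈W → ∉⇒~∈ W λ C∈W → ⟦⟧-elim W C∈W λ (τ , rτ , W⊩τ) →
      case reached⇒Reaches rτ of λ where
        (r , c , refl) → no-path (r , c , ∈⇒bit W⊩τ ψ∈Σ ψ∈W)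

    premise-□ : ∀ V → ~ C ⟶ □ (φ ⟶ ~ C) ∈W V
    premise-□ V = ⟶∈⁺ V λ ~C∈V → ∈-stable V λ □∉V →
      let W , h , V≤W = ~□-witness V (∉⇒~∈ V □∉V)
          φ∈W , ~~C∈W = ~⟶∈⁻ W h
      in ⟦⟧-elim W (~~∈⁻ W ~~C∈W) λ (σ , rσ , W⊩σ) → type-exists V Σ′ λ (τ , V⊩τ) →
         ~∈⇒∉ V ~C∈V (⟦⟧-intro V⊩τ
           (reached-closed rσ (∈⇒bit W⊩σ φ∈Σ φ∈W) (linked-via W⊩σ V⊩τ W⊩σ φ∈W (λ h → h) V≤W)))

    premise-◇ : ∀ V → φ ⋀ ◇ (φ ⋀ ~ C) ⟶ ~ C ∈W V
    premise-◇ V = ⟶∈⁺ V λ h → ∉⇒~∈ V λ C∈V →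
      let φ∈V , ◇∈V = ⋀∈⁻ V h
          W , h′ , V≤W = ~□-witness V ◇∈V
          φ∈W , ~C∈W = ⋀∈⁻ W (~~∈⁻ W h′)
      in ⟦⟧-elim V C∈V λ (σ , rσ , V⊩σ) → type-exists W Σ′ λ (τ , W⊩τ) →
         ~∈⇒∉ W ~C∈W (⟦⟧-intro W⊩τ
           (reached-closed rσ (∈⇒bit V⊩σ φ∈Σ φ∈V) (linked-via V⊩σ W⊩τ W⊩τ φ∈W V≤W (λ h → h))))

    valid-path : ¬ ¬ Σ Path Valid
    valid-path no-path =
      ∈-every⇒¬¬⊢ (premise-ψ no-path) λ ⊢ψ⟶~C → ∈-every⇒¬¬⊢ premise-□ λ ⊢□ → ∈-every⇒¬¬⊢ premise-◇ λ ⊢◇ →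
      let γ~C∈T₀ = ∈-mp T₀ γ∈T₀ (rule1 (⊢-taut (⊨⟶⁺ id)) ⊢ψ⟶~C)
          W , h , T₀≤W = ~□-witness T₀ (∈-mp T₀ γ~C∈T₀ (rule2 ⊢□ ⊢◇))
          φ∈W , ~C∈W = ⋀∈⁻ W (~~∈⁻ W h)
      in type-exists W Σ′ λ (τ , W⊩τ) →
         ~∈⇒∉ W ~C∈W (⟦⟧-intro W⊩τ (reached-start (linked-via T₀⊩τ₀ W⊩τ W⊩τ φ∈W T₀≤W (λ h → h))))

  ¬¬-valid-path : γ φ ψ ∈W T₀ → ¬ ¬ Σ Path Valid
  ¬¬-valid-path γ∈T₀ no-path =
    ¬¬-decide (λ (σ , τ) → ∈-cartesianProduct⁺ (types-complete σ) (types-complete τ)) (λ (σ , τ) → Linked σ τ)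
      λ linked? → type-exists T₀ Σ′ λ (τ₀ , T₀⊩τ₀) →
        Refutation.valid-path γ∈T₀ (λ σ τ → linked? (σ , τ)) τ₀ T₀⊩τ₀ no-path

  module Realisation (∃valid : ¬ ¬ Σ Path Valid) where

    open FirstWitness Valid

    Chosen : Path → Set
    Chosen = First (vectors steps (suc M))

    chosen-valid : ∀ {p} → Chosen p → Valid p
    chosen-valid = First⇒P _

    ∃chosen : ¬ ¬ Σ Path Chosen
    ∃chosen k = ∃valid λ (p , v) → ¬¬-First (paths-complete p) v k

    via-chosen : (W : Wc Λ) → (∀ {p} → Chosen p → a ∈W W) → a ∈W W
    via-chosen W h = ∈-stable W λ a∉ → ∃chosen λ (_ , c) → a∉ (h c)

    Selection : Set
    Selection = Σ (Path → Ty) λ f → ∀ {p} → Chosen p → Consistentᵗ (f p)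

    seed : Selection → FmSet
    seed (f , _) θ = ∀ {p} → Chosen p → θ ∈ char Σ′ (f p)

    seed-consistent : (F : Selection) → Consistent Λ (seed F)
    seed-consistent (f , con) l hs d = ∃chosen λ (_ , c) → Consistent-⊆ (λ h → h c) (con c) l hs d

    world : Selection → Wc Λ
    world F = proj₁ (lindenbaum (seed F) (seed-consistent F))

    world-⊩ : (F : Selection) → ∀ {p} → Chosen p → world F ⊩ proj₁ F p
    world-⊩ F c = ⊩-intro (All.tabulate λ θ∈ → proj₂ (lindenbaum (seed F) (seed-consistent F)) λ c′ →
      subst (λ q → _ ∈ char Σ′ (proj₁ F q)) (First-unique _ c c′) θ∈)

    world-∈ : (F : Selection) (a∈ : a ∈ Σ′) → (∀ {p} → Chosen p → T (bit a∈ (proj₁ F p))) → a ∈W world F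
    world-∈ F a∈ h = via-chosen (world F) λ c → bit⇒∈ (world-⊩ F c) a∈ (h c)

    world-≼ : (F G : Selection) → (∀ {p} → Chosen p → proj₁ F p ≤ᵗ proj₁ G p) → _≼_ Σ′ (world F) (world G)
    world-≼ F G h χ □χ∈ h□ = via-chosen (world G) λ c → ≤ᵗ⇒≼ (world-⊩ F c) (world-⊩ G c) (h c) χ □χ∈ h□

    T₀-≼ : (G : Selection) → (∀ {p} → Chosen p → Σ Ty λ τ₀ → T₀ ⊩ τ₀ × τ₀ ≤ᵗ proj₁ G p) → _≼_ Σ′ T₀ (world G)
    T₀-≼ G h χ □χ∈ h□ = via-chosen (world G) λ c →
      let _ , T₀⊩τ₀ , τ₀≤ = h c in ≤ᵗ⇒≼ T₀⊩τ₀ (world-⊩ G c) τ₀≤ χ □χ∈ h□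

    apex-sel target-sel : ∀ k (sel : Path → Vec Step (suc k)) → (∀ {p} → Chosen p → Chain k (sel p)) → Selection
    apex-sel k sel ch = apex ∘ head ∘ sel , λ c → apex-consistent (proj₂ (first-link k (ch c)))
    target-sel k sel ch = target ∘ head ∘ sel , λ c → target-consistent (proj₂ (first-link k (ch c)))

    R-along : ∀ k sel (ch : ∀ {p} → Chosen p → Chain k (sel p)) → R Σ′ φ T₀ (world (target-sel k sel ch))
    R-along zero sel ch =
      base (world A) (world-∈ A φ∈Σ λ c → φ∈apex (link c))
        (T₀-≼ A λ c → let τ₀ , T₀⊩τ₀ , l = ch c in τ₀ , T₀⊩τ₀ , below-apex l)
        (world-≼ X A λ c → target-below-apex (link c))
      where
        A X : Selection
        A = apex-sel zero sel ch
        X = target-sel zero sel ch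
        link : ∀ {p} (c : Chosen p) → Link (proj₁ (ch c)) (head (sel p))
        link c = proj₂ (proj₂ (ch c))
    R-along (suc k) sel ch =
      trans (world X′) (world-∈ X′ φ∈Σ λ c → proj₁ (proj₂ (ch c))) (R-along k (tail ∘ sel) ch′)
        (base (world A) (world-∈ A φ∈Σ λ c → φ∈apex (proj₁ (ch c)))
          (world-≼ X′ A λ c → below-apex (proj₁ (ch c)))
          (world-≼ X A λ c → target-below-apex (proj₁ (ch c))))
      where
        ch′ : ∀ {p} → Chosen p → Chain k (tail (sel p))
        ch′ c = proj₂ (proj₂ (ch c))
        A X X′ : Selection
        A = apex-sel (suc k) sel ch
        X = target-sel (suc k) sel ch
        X′ = target-sel k (tail ∘ sel) ch′

    result : Σ (Wc Λ) λ S → R Σ′ φ T₀ S × ψ ∈W S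
    result =
      world X , R-along M id (λ c → proj₁ (chosen-valid c)) , world-∈ X ψ∈Σ (λ c → proj₂ (chosen-valid c))
      where
        X : Selection
        X = target-sel M id (λ c → proj₁ (chosen-valid c))

mainTheorem13 : (Λ : Logic) (Σ′ : List Fm) → Adequate Σ′
    → (T : Wc Λ) (φ ψ : Fm) → γ φ ψ ∈W T → γ φ ψ ∈ Σ′
    → Σ (Wc Λ) (λ S → R Σ′ φ T S × ψ ∈W S)
mainTheorem13 _ Σ′ adequate T _ _ γ∈T γ∈Σ = Realisation.result (¬¬-valid-path γ∈T)
  where open Chains Σ′ T (Adequate.subClosed adequate γ∈Σ sγˡ) (Adequate.subClosed adequate γ∈Σ sγʳ)
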